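{- For every digraph $D$ of order $n$, $dac(D)\leq \left\lceil n-\frac{\mathcal{A}(D)}{2}\right\rceil$.
   Context: All digraphs are finite, loopless, and simple: $D=(V,A)$ where $A$ is a set of ordered pairs $uv$ (darts) of distinct vertices; both $uv$ and $vu$ may be darts. A coloring of $D$ with $k$ colors is a surjective map $\varsigma:V\to\{1,\dots,k\}$; it is acyclic if each color class induces a subdigraph with no directed cycle, and complete if for every ordered pair of distinct colors $(i,j)$ there is a dart $uv$ with $\varsigma(u)=i$ and $\varsigma(v)=j$. The diachromatic number $dac(D)$ is the largest $k$ for which $D$ has a complete acyclic coloring with $k$ colors. The acyclic number $\mathcal{A}(D)$ is the maximum number of vertices of a set $S\subseteq V$ whose induced subdigraph $D[S]$ contains no directed cycle. -}

module Defs where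

open import Data.Nat using (ℕ; zero; suc; _≤_; _∸_; ⌊_/2⌋)
open import Data.Fin using (Fin; zero; suc; inject₁; fromℕ)
open import Data.Fin.Subset using (Subset; _∈_; ∣_∣)
open import Data.Product using (Σ; ∃; _×_)
open import Relation.Binary.PropositionalEquality using (_≡_; _≢_)
open import Relation.Nullary using (¬_)
open import Function.Definitions using (Injective; Surjective)

record Digraph (n : ℕ) : Set₁ where
  field
    Dart     : Fin n → Fin n → Set
    loopless : ∀ v → ¬ Dart v v
open Digraph public

-- A directed cycle of length (suc k) ≥ 2 on distinct vertices c 0, …, c k,
-- with darts c i → c (i+1) and c k → c 0, all of whose vertices satisfy P
-- (i.e. a directed cycle of the induced subdigraph D[P]).
record DirCycleIn {n : ℕ} (D : Digraph n) (P : Fin n → Set) : Set where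
  field
    k        : ℕ
    k≥1      : 1 ≤ k
    c        : Fin (suc k) → Fin n
    distinct : Injective _≡_ _≡_ c
    inP      : ∀ i → P (c i)
    step     : ∀ (i : Fin k) → Dart D (c (inject₁ i)) (c (suc i))
    close    : Dart D (c (fromℕ k)) (c zero)

AcyclicOn : ∀ {n} → Digraph n → (Fin n → Set) → Set
AcyclicOn D P = ¬ DirCycleIn D P

AcyclicSet : ∀ {n} → Digraph n → Subset n → Set
AcyclicSet D S = AcyclicOn D (λ v → v ∈ S)

-- S witnesses the acyclic number: |S| = 𝒜(D).
IsMaxAcyclicSet : ∀ {n} → Digraph n → Subset n → Set
IsMaxAcyclicSet {n} D S = AcyclicSet D S × (∀ (T : Subset n) → AcyclicSet D T → ∣ T ∣ ≤ ∣ S ∣)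

record CompleteAcyclicColoring {n : ℕ} (D : Digraph n) (k : ℕ) : Set where
  field
    col        : Fin n → Fin k
    surjective : Surjective _≡_ _≡_ col
    acyclic    : ∀ (i : Fin k) → AcyclicOn D (λ v → col v ≡ i)
    complete   : ∀ (i j : Fin k) → i ≢ j →
                   ∃ λ u → ∃ λ v → Dart D u v × col u ≡ i × col v ≡ j

{-# OPTIONS --safe #-}
module Submission where

-- A color class with c vertices, s of them in the acyclic set S, satisfies
-- 2 + s ≤ 2c, except when it is a singleton {u} with u ∈ S, where 2 + s = 2c + 1.
-- Two such singleton classes {u}, {v} cannot coexist: completeness gives darts
-- u → v and v → u, a directed 2-cycle inside S.  Summing over the k classes
-- yields 2k + |S| ≤ 2n + 1.  Only completeness of the coloring and acyclicity
-- (not maximality) of S are used.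

open import Defs
open import Data.Bool using (if_then_else_)
open import Data.Fin as Fin using (Fin; zero; suc; punchIn; punchOut)
open import Data.Fin.Properties using (punchInᵢ≢i; punchIn-punchOut)
open import Data.Fin.Subset using (Subset; ∣_∣; inside; outside; _∈_)
open import Data.Fin.Subset.Properties using (_∈?_)
open import Data.Nat using (ℕ; zero; suc; _+_; _*_; _≤_; _<_; _∸_; z≤n; s≤s; z<s; ⌊_/2⌋; ⌈_/2⌉)
open import Data.Nat.Properties
open import Data.Product using (∃; _×_; _,_)
open import Data.Vec using (_∷_; [])
open import Function using (_∘_; const)
open import Relation.Nullary using (¬_; Dec; yes; no; does; contradiction; _×-dec_)
open import Relation.Binary.PropositionalEquality

open import Algebra.Properties.CommutativeSemigroup +-commutativeSemigroup using (interchange)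
open import Algebra.Properties.Semiring.Sum +-*-semiring
  using (sum; sum-syntax; sum-cong-≗; sum-replicate-zero; sum-remove; ∑-comm; ∑-distrib-+; *-distribʳ-sum)

-- χ inspects only `does`, so χ (Dec.map′ f g d) reduces to χ d; ∣p∣≡∑χ∈ relies on this.
χ : ∀ {A : Set} → Dec A → ℕ
χ d = if does d then 1 else 0

module _ {A : Set} where

  χ≤1 : (d : Dec A) → χ d ≤ 1
  χ≤1 (yes _) = ≤-refl
  χ≤1 (no _)  = z≤n

  χ-yes : (d : Dec A) → A → χ d ≡ 1
  χ-yes (yes _) _ = refl
  χ-yes (no ¬a) a = contradiction a ¬a

  χ-no : (d : Dec A) → ¬ A → χ d ≡ 0
  χ-no (yes a) ¬a = contradiction a ¬a
  χ-no (no _)  _  = refl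

  χ-pos : (d : Dec A) → 0 < χ d → A
  χ-pos (yes a) _ = a

  χ*-pos : (d : Dec A) (m : ℕ) → 0 < χ d * m → A × 0 < m
  χ*-pos (yes a) m 0<m = a , subst (0 <_) (*-identityˡ m) 0<m

∑-1 : ∀ n → ∑[ i < n ] 1 ≡ n
∑-1 zero    = refl
∑-1 (suc n) = cong suc (∑-1 n)

sum-mono-≤ : ∀ {n} {f g : Fin n → ℕ} → (∀ i → f i ≤ g i) → sum f ≤ sum g
sum-mono-≤ {zero}  f≤g = z≤n
sum-mono-≤ {suc n} f≤g = +-mono-≤ (f≤g zero) (sum-mono-≤ (f≤g ∘ suc))

lookup≤sum : ∀ {n} (f : Fin n → ℕ) i → f i ≤ sum f
lookup≤sum f zero    = m≤m+n _ _
lookup≤sum f (suc i) = ≤-trans (lookup≤sum (f ∘ suc) i) (m≤n+m _ _)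

sum-pos : ∀ {n} (f : Fin n → ℕ) → 0 < sum f → ∃ λ i → 0 < f i
sum-pos {suc n} f 0<∑f with f zero in f₀≡
... | suc _ = zero , subst (0 <_) (sym f₀≡) z<s
... | zero  with sum-pos (f ∘ suc) 0<∑f
...   | i , 0<fi = suc i , 0<fi

sum-supported : ∀ {n} (f : Fin n → ℕ) i → (∀ j → j ≢ i → f j ≡ 0) → sum f ≡ f i
sum-supported {suc n} f i f≡0 = begin
  sum f                            ≡⟨ sum-remove f ⟩
  f i + ∑[ j < n ] f (punchIn i j) ≡⟨ cong (f i +_) (sum-cong-≗ (λ j → f≡0 _ (punchInᵢ≢i i j))) ⟩
  f i + ∑[ j < n ] 0               ≡⟨ cong (f i +_) (sum-replicate-zero n) ⟩
  f i + 0                          ≡⟨ +-identityʳ (f i) ⟩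
  f i                              ∎
  where open ≡-Reasoning

sum≤1⇒unique-pos : ∀ {n} (f : Fin n → ℕ) → sum f ≤ 1 → ∀ {i j} → 0 < f i → 0 < f j → i ≡ j
sum≤1⇒unique-pos {suc n} f ∑f≤1 {i} {j} 0<fi 0<fj with i Fin.≟ j
... | yes i≡j = i≡j
... | no  i≢j = contradiction ∑f≤1 (<⇒≱ (begin-strict
  1                                        <⟨ +-mono-≤ 0<fi 0<fj ⟩
  f i + f j                                ≡⟨ cong (λ j′ → f i + f j′) (punchIn-punchOut i≢j) ⟨
  f i + f (punchIn i (punchOut i≢j))       ≤⟨ +-monoʳ-≤ (f i) (lookup≤sum (f ∘ punchIn i) _) ⟩
  f i + ∑[ j < n ] f (punchIn i j)         ≡⟨ sum-remove f ⟨
  sum f                                    ∎))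
  where open ≤-Reasoning

unique-pos⇒sum≤1 : ∀ {n} (f : Fin n → ℕ) → (∀ i → f i ≤ 1) →
                    (∀ {i j} → 0 < f i → 0 < f j → i ≡ j) → sum f ≤ 1
unique-pos⇒sum≤1 f f≤1 pos-unique = ≮⇒≥ λ 1<∑f →
  let i , 0<fi = sum-pos f (<-trans z<s 1<∑f)
      f-off-i : ∀ j → j ≢ i → f j ≡ 0
      f-off-i j j≢i = n≤0⇒n≡0 (≮⇒≥ λ 0<fj → j≢i (pos-unique 0<fj 0<fi))
  in <⇒≱ 1<∑f (≤-trans (≤-reflexive (sum-supported f i f-off-i)) (f≤1 i))

∑-χ-≟ : ∀ {k} (c : Fin k) → ∑[ i < k ] χ (c Fin.≟ i) ≡ 1
∑-χ-≟ c = trans (sum-supported (λ i → χ (c Fin.≟ i)) c (λ j j≢c → χ-no (c Fin.≟ j) (j≢c ∘ sym)))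
                (χ-yes (c Fin.≟ c) refl)

∣p∣≡∑χ∈ : ∀ {n} (p : Subset n) → ∣ p ∣ ≡ ∑[ v < n ] χ (v ∈? p)
∣p∣≡∑χ∈ []            = refl
∣p∣≡∑χ∈ (inside ∷ p)  = cong suc (∣p∣≡∑χ∈ p)
∣p∣≡∑χ∈ (outside ∷ p) = ∣p∣≡∑χ∈ p

module ColorClasses {n k} (col : Fin n → Fin k) where

  classWeight : (Fin n → ℕ) → Fin k → ℕ
  classWeight w i = ∑[ v < n ] (χ (col v Fin.≟ i) * w v)

  ∑-classWeight : (w : Fin n → ℕ) → ∑[ i < k ] classWeight w i ≡ ∑[ v < n ] w v
  ∑-classWeight w = begin
    ∑[ i < k ] ∑[ v < n ] (χ (col v Fin.≟ i) * w v)
      ≡⟨ ∑-comm (λ i v → χ (col v Fin.≟ i) * w v) ⟩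
    ∑[ v < n ] ∑[ i < k ] (χ (col v Fin.≟ i) * w v)
      ≡⟨ sum-cong-≗ (λ v → *-distribʳ-sum (w v) (λ i → χ (col v Fin.≟ i))) ⟨
    ∑[ v < n ] ((∑[ i < k ] χ (col v Fin.≟ i)) * w v)
      ≡⟨ sum-cong-≗ (λ v → cong (_* w v) (∑-χ-≟ (col v))) ⟩
    ∑[ v < n ] (1 * w v)
      ≡⟨ sum-cong-≗ (λ v → *-identityˡ (w v)) ⟩
    ∑[ v < n ] w v ∎
    where open ≡-Reasoning

  classWeight-mono : {w w′ : Fin n → ℕ} → (∀ v → w v ≤ w′ v) → ∀ i → classWeight w i ≤ classWeight w′ i
  classWeight-mono w≤w′ i = sum-mono-≤ (λ v → *-monoʳ-≤ (χ (col v Fin.≟ i)) (w≤w′ v))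

  classTerm-member : (w : Fin n → ℕ) {i : Fin k} {v : Fin n} → col v ≡ i → χ (col v Fin.≟ i) * w v ≡ w v
  classTerm-member w {i} {v} cv≡i =
    trans (cong (_* w v) (χ-yes (col v Fin.≟ i) cv≡i)) (*-identityˡ (w v))

  member≤classWeight : (w : Fin n → ℕ) {i : Fin k} {v : Fin n} → col v ≡ i → w v ≤ classWeight w i
  member≤classWeight w {i} {v} cv≡i =
    subst (_≤ classWeight w i) (classTerm-member w cv≡i) (lookup≤sum (λ u → χ (col u Fin.≟ i) * w u) v)

  classWeight-pos : (w : Fin n → ℕ) {i : Fin k} → 0 < classWeight w i → ∃ λ v → col v ≡ i × 0 < w v
  classWeight-pos w {i} 0<cw with sum-pos _ 0<cw
  ... | v , 0<χw = v , χ*-pos (col v Fin.≟ i) (w v) 0<χw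

  classSize : Fin k → ℕ
  classSize = classWeight (const 1)

  classSizeIn : Subset n → Fin k → ℕ
  classSizeIn S = classWeight (λ v → χ (v ∈? S))

  ∑-classSize : ∑[ i < k ] classSize i ≡ n
  ∑-classSize = trans (∑-classWeight (const 1)) (∑-1 n)

  ∑-classSizeIn : ∀ S → ∑[ i < k ] classSizeIn S i ≡ ∣ S ∣
  ∑-classSizeIn S = trans (∑-classWeight (λ v → χ (v ∈? S))) (sym (∣p∣≡∑χ∈ S))

  classSizeIn≤classSize : ∀ S i → classSizeIn S i ≤ classSize i
  classSizeIn≤classSize S = classWeight-mono (λ v → χ≤1 (v ∈? S))

  classSize≡1-unique : ∀ {i u v} → classSize i ≡ 1 → col u ≡ i → col v ≡ i → v ≡ u
  classSize≡1-unique {i} size≡1 cu≡i cv≡i =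
    sum≤1⇒unique-pos _ (≤-reflexive size≡1) (member-pos cv≡i) (member-pos cu≡i)
    where
    member-pos : ∀ {v} → col v ≡ i → 0 < χ (col v Fin.≟ i) * 1
    member-pos cv≡i = ≤-reflexive (sym (classTerm-member (const 1) cv≡i))

digon⇒cycle : ∀ {n} (D : Digraph n) {P : Fin n → Set} {u v} →
              u ≢ v → P u → P v → Dart D u v → Dart D v u → DirCycleIn D P
digon⇒cycle D {P} {u} {v} u≢v Pu Pv uv vu = record
  { k = 1 ; k≥1 = ≤-refl ; c = c ; distinct = distinct ; inP = inP
  ; step = λ { zero → uv } ; close = vu }
  where
  c : Fin 2 → Fin _
  c zero       = u
  c (suc zero) = v

  distinct : ∀ {x y} → c x ≡ c y → x ≡ y
  distinct {zero}     {zero}     _   = refl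
  distinct {zero}     {suc zero} u≡v = contradiction u≡v u≢v
  distinct {suc zero} {zero}     v≡u = contradiction (sym v≡u) u≢v
  distinct {suc zero} {suc zero} _   = refl

  inP : ∀ x → P (c x)
  inP zero       = Pu
  inP (suc zero) = Pv

module _ {n k} {D : Digraph n} (C : CompleteAcyclicColoring D k) where
  open CompleteAcyclicColoring C

  dart-between-singletons : ∀ {i j u v} → i ≢ j →
    (∀ w → col w ≡ i → w ≡ u) → (∀ w → col w ≡ j → w ≡ v) → Dart D u v
  dart-between-singletons i≢j only-u only-v with complete _ _ i≢j
  ... | u′ , v′ , u′v′ , cu′ , cv′ = subst₂ (Dart D) (only-u u′ cu′) (only-v v′ cv′) u′v′

class-bound : ∀ {c s} → 0 < c → s ≤ c → 1 + 1 + s ≤ c + c + χ (c ≟ 1 ×-dec s ≟ 1)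
class-bound {1}           {0}           _ _         = ≤-refl
class-bound {1}           {1}           _ _         = ≤-refl
class-bound {1}           {suc (suc _)} _ (s≤s ())
class-bound {suc (suc c)} {s}           _ s≤c       = begin
  2 + s                         ≤⟨ +-monoʳ-≤ 2 s≤c ⟩
  2 + (2 + c)                   ≤⟨ +-monoˡ-≤ (2 + c) (m≤m+n 2 c) ⟩
  (2 + c) + (2 + c)             ≤⟨ m≤m+n _ _ ⟩
  (2 + c) + (2 + c) + χ (2 + c ≟ 1 ×-dec s ≟ 1) ∎
  where open ≤-Reasoning

m+m≤1+n+n⇒m≤n : ∀ {m n} → m + m ≤ suc (n + n) → m ≤ n
m+m≤1+n+n⇒m≤n {m} {n} m+m≤ = ≮⇒≥ λ n<m → n≮n (suc (n + n)) (begin-strict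
  suc (n + n)     <⟨ s≤s (≤-reflexive (sym (+-suc n n))) ⟩
  suc n + suc n   ≤⟨ +-mono-≤ n<m n<m ⟩
  m + m           ≤⟨ m+m≤ ⟩
  suc (n + n)     ∎)
  where open ≤-Reasoning

k+k+a≤1+n+n⇒k≤n∸⌊a/2⌋ : ∀ {k a n} → k + k + a ≤ suc (n + n) → k ≤ n ∸ ⌊ a /2⌋
k+k+a≤1+n+n⇒k≤n∸⌊a/2⌋ {k} {a} {n} k+k+a≤ = m+n≤o⇒m≤o∸n k (m+m≤1+n+n⇒m≤n (begin
  (k + ⌊ a /2⌋) + (k + ⌊ a /2⌋)  ≡⟨ interchange k ⌊ a /2⌋ k ⌊ a /2⌋ ⟩
  (k + k) + (⌊ a /2⌋ + ⌊ a /2⌋)  ≤⟨ +-monoʳ-≤ (k + k) (+-monoʳ-≤ ⌊ a /2⌋ (⌊n/2⌋≤⌈n/2⌉ a)) ⟩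
  (k + k) + (⌊ a /2⌋ + ⌈ a /2⌉)  ≡⟨ cong (k + k +_) (⌊n/2⌋+⌈n/2⌉≡n a) ⟩
  k + k + a                      ≤⟨ k+k+a≤ ⟩
  suc (n + n)                    ∎))
  where open ≤-Reasoning

module DoubleCounting {n k} {D : Digraph n} {S : Subset n}
                      (acyclic-S : AcyclicSet D S) (C : CompleteAcyclicColoring D k) where
  open CompleteAcyclicColoring C
  open ColorClasses col

  classSize-pos : ∀ i → 0 < classSize i
  classSize-pos i with surjective i
  ... | v , col⁻¹i = member≤classWeight (const 1) (col⁻¹i refl)

  exceptional : Fin k → ℕ
  exceptional i = χ (classSize i ≟ 1 ×-dec classSizeIn S i ≟ 1)

  exceptional-singleton : ∀ {i} → 0 < exceptional i →
    ∃ λ u → col u ≡ i × u ∈ S × (∀ v → col v ≡ i → v ≡ u)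
  exceptional-singleton {i} 0<e with χ-pos (classSize i ≟ 1 ×-dec classSizeIn S i ≟ 1) 0<e
  ... | size≡1 , sizeIn≡1 with classWeight-pos _ (≤-reflexive (sym sizeIn≡1))
  ...   | u , cu≡i , 0<χ =
    u , cu≡i , χ-pos (u ∈? S) 0<χ , λ v cv≡i → classSize≡1-unique size≡1 cu≡i cv≡i

  exceptional-unique : ∀ {i j} → 0 < exceptional i → 0 < exceptional j → i ≡ j
  exceptional-unique {i} {j} 0<eᵢ 0<eⱼ with i Fin.≟ j
  ... | yes i≡j = i≡j
  ... | no  i≢j with exceptional-singleton 0<eᵢ | exceptional-singleton 0<eⱼ
  ...   | u , cu≡i , u∈S , only-u | v , cv≡j , v∈S , only-v = contradiction digon acyclic-S
    where
    u≢v : u ≢ v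
    u≢v u≡v = i≢j (trans (sym cu≡i) (trans (cong col u≡v) cv≡j))

    digon : DirCycleIn D (_∈ S)
    digon = digon⇒cycle D u≢v u∈S v∈S (dart-between-singletons C i≢j only-u only-v)
                                      (dart-between-singletons C (i≢j ∘ sym) only-v only-u)

  ∑-exceptional≤1 : ∑[ i < k ] exceptional i ≤ 1
  ∑-exceptional≤1 = unique-pos⇒sum≤1 exceptional
    (λ i → χ≤1 (classSize i ≟ 1 ×-dec classSizeIn S i ≟ 1)) exceptional-unique

  k+k+∣S∣≤1+n+n : k + k + ∣ S ∣ ≤ suc (n + n)
  k+k+∣S∣≤1+n+n = begin
    k + k + ∣ S ∣
      ≡⟨ cong₂ _+_ (cong₂ _+_ (∑-1 k) (∑-1 k)) (∑-classSizeIn S) ⟨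
    ∑[ i < k ] 1 + ∑[ i < k ] 1 + ∑[ i < k ] classSizeIn S i
      ≡⟨ cong (_+ ∑[ i < k ] classSizeIn S i) (∑-distrib-+ {k} (const 1) (const 1)) ⟨
    ∑[ i < k ] (1 + 1) + ∑[ i < k ] classSizeIn S i
      ≡⟨ ∑-distrib-+ (const 2) (classSizeIn S) ⟨
    ∑[ i < k ] (1 + 1 + classSizeIn S i)
      ≤⟨ sum-mono-≤ (λ i → class-bound (classSize-pos i) (classSizeIn≤classSize S i)) ⟩
    ∑[ i < k ] (classSize i + classSize i + exceptional i)
      ≡⟨ ∑-distrib-+ (λ i → classSize i + classSize i) exceptional ⟩
    ∑[ i < k ] (classSize i + classSize i) + ∑[ i < k ] exceptional i
      ≡⟨ cong (_+ ∑[ i < k ] exceptional i) (∑-distrib-+ classSize classSize) ⟩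
    ∑[ i < k ] classSize i + ∑[ i < k ] classSize i + ∑[ i < k ] exceptional i
      ≡⟨ cong (λ m → m + m + ∑[ i < k ] exceptional i) ∑-classSize ⟩
    n + n + ∑[ i < k ] exceptional i
      ≤⟨ +-monoʳ-≤ (n + n) ∑-exceptional≤1 ⟩
    n + n + 1
      ≡⟨ +-comm (n + n) 1 ⟩
    suc (n + n) ∎
    where open ≤-Reasoning

corollary6 : ∀ (n : ℕ) (D : Digraph n) (S : Subset n) → IsMaxAcyclicSet D S →
               ∀ (k : ℕ) → CompleteAcyclicColoring D k → k ≤ n ∸ ⌊ ∣ S ∣ /2⌋
corollary6 n D S (acyclic-S , _) k C = k+k+a≤1+n+n⇒k≤n∸⌊a/2⌋ (DoubleCounting.k+k+∣S∣≤1+n+n acyclic-S C)
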